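{- If a graph has $k$ nontrivial connected components, then it has $\Omega(2^k)$ minimal zero forcing sets, and indeed $\Omega(2^k)$ minimum zero forcing sets.
   Context: All graphs are finite, simple and undirected. A connected component is trivial if it consists of a single vertex, and nontrivial otherwise. Given a set $S$ of initially blue vertices (all others white), the zero forcing color change rule says that a blue vertex with exactly one white neighbor causes that neighbor to become blue. $S$ is a zero forcing set if repeatedly applying this rule eventually makes every vertex blue. A minimal zero forcing set is a zero forcing set containing no other zero forcing set as a proper subset; a minimum zero forcing set is a zero forcing set of smallest possible cardinality. -}

module Defs where

open import Data.Nat using (ℕ; _≤_; _*_; _^_)
open import Data.Bool using (Bool; true; false)
open import Data.Fin using (Fin)
open import Data.Fin.Subset using (Subset; _∈_; _∉_; _⊂_; _∪_; ⁅_⁆; ⊤; ∣_∣)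
open import Data.Product using (Σ; ∃; _×_)
open import Data.List using (List; length)
open import Data.List.Relation.Unary.All using (All)
open import Data.List.Relation.Unary.Unique.Propositional using (Unique)
open import Relation.Binary.PropositionalEquality using (_≡_; _≢_)
open import Relation.Binary.Construct.Closure.ReflexiveTransitive using (Star)
open import Relation.Nullary using (¬_)

record Graph (n : ℕ) : Set where
  field
    adj     : Fin n → Fin n → Bool
    sym     : ∀ u v → adj u v ≡ adj v u
    irrefl  : ∀ v → adj v v ≡ false

module _ {n : ℕ} (G : Graph n) where
  open Graph G

  Adj : Fin n → Fin n → Set
  Adj u v = adj u v ≡ true

  Connected : Fin n → Fin n → Set
  Connected = Star Adj

  -- G has exactly k nontrivial connected components: there are k vertices
  -- r 0, …, r (k-1), lying in pairwise distinct components, each component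
  -- nontrivial (r i has a neighbour), and every vertex of a nontrivial
  -- component (i.e. every non-isolated vertex) lies in one of them.
  HasNontrivialComponents : ℕ → Set
  HasNontrivialComponents k =
    Σ (Fin k → Fin n) λ r →
      (∀ i j → Connected (r i) (r j) → i ≡ j) ×
      (∀ i → ∃ λ w → Adj (r i) w) ×
      (∀ v → (∃ λ w → Adj v w) → ∃ λ i → Connected v (r i))

  Force : Subset n → Subset n → Set
  Force B B′ = ∃ λ v → ∃ λ w →
    v ∈ B × w ∉ B × Adj v w ×
    (∀ u → Adj v u → u ≢ w → u ∈ B) ×
    B′ ≡ B ∪ ⁅ w ⁆

  ZeroForcing : Subset n → Set
  ZeroForcing S = Star Force S ⊤

  MinimalZF : Subset n → Set
  MinimalZF S = ZeroForcing S × (∀ T → T ⊂ S → ¬ ZeroForcing T)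

  MinimumZF : Subset n → Set
  MinimumZF S = ZeroForcing S × (∀ T → ZeroForcing T → ∣ S ∣ ≤ ∣ T ∣)

-- "f(G) = Ω(2^k)": ∃ constants C, k₀ such that for all graphs with k ≥ k₀
-- nontrivial components, there are at least 2^k / C such sets.
OmegaTwoPow : ({n : ℕ} → Graph n → Subset n → Set) → Set
OmegaTwoPow P = Σ ℕ λ C → Σ ℕ λ k₀ →
  ∀ (n : ℕ) (G : Graph n) (k : ℕ) → HasNontrivialComponents G k → k₀ ≤ k →
    Σ (List (Subset n)) λ L → Unique L × All (P G) L × 2 ^ k ≤ C * length L

-- Fix a minimum zero forcing set S together with a chronological list of forces.
-- Inside any union Q of components, run the forcing chains backwards: the vertices
-- of Q that never force form, together with S outside Q, another zero forcing set,
-- and it is no larger than S, hence again minimum. Every nontrivial component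
-- contains a vertex of S that forces, and such a vertex lies in the new set exactly
-- when its component is outside Q; so the 2^k choices of Q give distinct sets.
module Submission where

open import Defs
open import Data.Bool using (Bool; true; false; not; if_then_else_)
import Data.Bool.Properties as Bool
open import Data.Empty using (⊥-elim)
open import Data.Fin using (Fin; zero; suc; _≟_)
open import Data.Fin.Properties using (any?; all?; suc-injective; 0≢1+n)
open import Data.Fin.Subset
  using (Subset; inside; outside; _∈_; _∉_; _⊆_; _⊂_; _⊃_; _∪_; _-_; ⁅_⁆; ⊤; ∁; ∣_∣)
open import Data.Fin.Subset.Properties
  using ( _∈?_; ∈⊤; ⊆⊤; ⊆-antisym; x∈⁅x⁆; x∈⁅y⁆⇒x≡y; x∈p∪q⁺; x∈p∪q⁻; p⊆p∪q
        ; x∈p∧x≢y⇒x∈p-y; x∈p⇒∣p-x∣<∣p∣; p⊂q⇒∣p∣<∣q∣; ∣p∣≤n; ∣∁p∣≡n∸∣p∣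
        ; x∈∁p⇒x∉p; x∉p⇒x∈∁p; anySubset?)
open import Data.Fin.Subset.Induction using (⊃-wellFounded)
open import Data.List using (List; [_]; map; _++_; length)
open import Data.List.Properties using (length-map; length-++)
import Data.List.Membership.Propositional as List
open import Data.List.Membership.Propositional.Properties using (∈-map⁻)
open import Data.List.Relation.Unary.All as All using (All)
import Data.List.Relation.Unary.All.Properties as All
open import Data.List.Relation.Unary.Unique.Propositional using (Unique)
import Data.List.Relation.Unary.AllPairs as AllPairs
import Data.List.Relation.Unary.Unique.Propositional.Properties as Unique
open import Data.Maybe using (Maybe; just; nothing; maybe′)
open import Data.Nat using (ℕ; zero; suc; _+_; _*_; _^_; _∸_; _≤_; _<_; z≤n; s≤s; _<?_; _⊔_)
open import Data.Nat.Induction using (<-wellFounded)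
open import Data.Nat.Properties
  using ( ≤-refl; ≤-reflexive; ≤-trans; <⇒≤; <⇒≱; ≮⇒≥; <-asym; <-≤-trans; ≤-<-trans
        ; m≤m⊔n; m≤n⊔m; +-identityʳ; *-identityˡ; m<n⇒0<n∸m; ∸-monoʳ-<; ∸-cancelʳ-≤
        ; module ≤-Reasoning)
open import Data.Product using (Σ; ∃; _×_; _,_; proj₁; proj₂)
open import Data.Sum using (_⊎_; inj₁; inj₂)
open import Data.Vec using ([]; _∷_; here; there; lookup; tabulate)
open import Data.Vec.Properties
  using (≡-dec; ∷-injectiveʳ; lookup∘tabulate; tabulate∘lookup; tabulate-cong; []=⇒lookup; lookup⇒[]=)
open import Function using (_∘_; id)
open import Induction.WellFounded using (Acc; acc)
open import Level using (0ℓ)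
open import Relation.Binary.PropositionalEquality
  using (_≡_; _≢_; refl; sym; trans; cong; cong₂; subst; subst₂; module ≡-Reasoning)
open import Relation.Binary.Construct.Closure.ReflexiveTransitive using (Star; ε; _◅_; _◅◅_; reverse)
open import Relation.Nullary using (¬_; Dec; yes; no; does; ¬?; contradiction)
open import Relation.Nullary.Decidable using (_×-dec_; _⊎-dec_; _→-dec_; dec-true; dec-false)
open import Relation.Unary using (Pred; Decidable)

Searchable : Set → Set₁
Searchable A = ∀ {P : Pred A 0ℓ} → Decidable P → Dec (∃ P)

argmin : ∀ {A : Set} → Searchable A → (f : A → ℕ) {P : Pred A 0ℓ} → Decidable P →
         ∃ P → ∃ λ a → P a × ∀ b → P b → f a ≤ f b
argmin search f {P} P? (a , pa) = go a (<-wellFounded (f a)) pa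
  where
  go : ∀ a → Acc _<_ (f a) → P a → ∃ λ a → P a × ∀ b → P b → f a ≤ f b
  go a (acc rs) pa with search (λ b → P? b ×-dec f b <? f a)
  ... | yes (b , pb , fb<fa) = go b (rs fb<fa) pb
  ... | no none = a , pa , λ b pb → ≮⇒≥ λ fb<fa → none (b , pb , fb<fa)

strictUpperBound : ∀ {n} (f : Fin n → ℕ) → ∃ λ M → ∀ x → f x < M
strictUpperBound {zero} f = 0 , λ ()
strictUpperBound {suc n} f with strictUpperBound (f ∘ suc)
... | M , bound = suc (f zero) ⊔ M , λ where
  zero    → m≤m⊔n (suc (f zero)) M
  (suc x) → <-≤-trans (bound x) (m≤n⊔m (suc (f zero)) M)

fromDec : ∀ {n} {P : Pred (Fin n) 0ℓ} → Decidable P → Subset n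
fromDec P? = tabulate (does ∘ P?)

module _ {n} {P : Pred (Fin n) 0ℓ} (P? : Decidable P) {x : Fin n} where

  lookup-fromDec : lookup (fromDec P?) x ≡ does (P? x)
  lookup-fromDec = lookup∘tabulate (does ∘ P?) x

  ∈-fromDec⁺ : P x → x ∈ fromDec P?
  ∈-fromDec⁺ px = lookup⇒[]= x _ (trans lookup-fromDec (dec-true (P? x) px))

  ∈-fromDec⁻ : x ∈ fromDec P? → P x
  ∈-fromDec⁻ x∈ with P? x | trans (sym lookup-fromDec) ([]=⇒lookup x∈)
  ... | yes px | _ = px
  ... | no _   | ()

x∉p-x : ∀ {n} (p : Subset n) (x : Fin n) → x ∉ p - x
x∉p-x (inside  ∷ p) zero ()
x∉p-x (outside ∷ p) zero ()
x∉p-x (_ ∷ p) (suc x) (there x∈) = x∉p-x p x x∈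

x∈p∪⁅x⁆ : ∀ {n} (p : Subset n) x → x ∈ p ∪ ⁅ x ⁆
x∈p∪⁅x⁆ p x = x∈p∪q⁺ (inj₂ (x∈⁅x⁆ x))

x∉p∪⁅y⁆ : ∀ {n} {p : Subset n} {x y} → x ∉ p → x ≢ y → x ∉ p ∪ ⁅ y ⁆
x∉p∪⁅y⁆ {p = p} {y = y} x∉p x≢y x∈ with x∈p∪q⁻ p ⁅ y ⁆ x∈
... | inj₁ x∈p = x∉p x∈p
... | inj₂ x∈y = x≢y (x∈⁅y⁆⇒x≡y y x∈y)

p∪⁅x⁆⊆q : ∀ {n} {p q : Subset n} {x} → p ⊆ q → x ∈ q → p ∪ ⁅ x ⁆ ⊆ q
p∪⁅x⁆⊆q {p = p} {q} {x} p⊆q x∈q y∈ with x∈p∪q⁻ p ⁅ x ⁆ y∈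
... | inj₁ y∈p = p⊆q y∈p
... | inj₂ y∈x = subst (_∈ q) (sym (x∈⁅y⁆⇒x≡y x y∈x)) x∈q

p⊂p∪⁅x⁆ : ∀ {n} {p : Subset n} {x} → x ∉ p → p ⊂ p ∪ ⁅ x ⁆
p⊂p∪⁅x⁆ {p = p} {x} x∉p = p⊆p∪q ⁅ x ⁆ , x , x∈p∪⁅x⁆ p x , x∉p

p⊆p-x∪⁅x⁆ : ∀ {n} (p : Subset n) x → p ⊆ (p - x) ∪ ⁅ x ⁆
p⊆p-x∪⁅x⁆ p x {y} y∈ with y ≟ x
... | yes refl = x∈p∪⁅x⁆ (p - y) y
... | no y≢x   = x∈p∪q⁺ (inj₁ (x∈p∧x≢y⇒x∈p-y y∈ y≢x))

injection⇒∣p∣≤∣q∣ : ∀ {m n} {p : Subset n} {q : Subset m} (f : Fin n → Fin m) →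
  (∀ {x} → x ∈ p → f x ∈ q) → (∀ {x y} → x ∈ p → y ∈ p → f x ≡ f y → x ≡ y) →
  ∣ p ∣ ≤ ∣ q ∣
injection⇒∣p∣≤∣q∣ {p = []} f _ _ = z≤n
injection⇒∣p∣≤∣q∣ {p = outside ∷ p} f into inj =
  injection⇒∣p∣≤∣q∣ (f ∘ suc) (into ∘ there)
    (λ x∈ y∈ e → suc-injective (inj (there x∈) (there y∈) e))
injection⇒∣p∣≤∣q∣ {p = inside ∷ p} {q} f into inj = begin-strict
  ∣ p ∣           ≤⟨ injection⇒∣p∣≤∣q∣ (f ∘ suc) into′ inj′ ⟩
  ∣ q - f zero ∣  <⟨ x∈p⇒∣p-x∣<∣p∣ (into here) ⟩
  ∣ q ∣           ∎
  where
  open ≤-Reasoning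
  into′ : ∀ {x} → x ∈ p → f (suc x) ∈ q - f zero
  into′ x∈ = x∈p∧x≢y⇒x∈p-y (into (there x∈))
               (λ e → 0≢1+n (inj here (there x∈) (sym e)))
  inj′ : ∀ {x y} → x ∈ p → y ∈ p → f (suc x) ≡ f (suc y) → x ≡ y
  inj′ x∈ y∈ e = suc-injective (inj (there x∈) (there y∈) e)

∣∁p∣≤∣∁q∣⇒∣q∣≤∣p∣ : ∀ {n} (p q : Subset n) → ∣ ∁ p ∣ ≤ ∣ ∁ q ∣ → ∣ q ∣ ≤ ∣ p ∣
∣∁p∣≤∣∁q∣⇒∣q∣≤∣p∣ p q h =
  ∸-cancelʳ-≤ (∣p∣≤n q) (subst₂ _≤_ (∣∁p∣≡n∸∣p∣ p) (∣∁p∣≡n∸∣p∣ q) h)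

allSubsets : ∀ k → List (Subset k)
allSubsets zero    = [ [] ]
allSubsets (suc k) = map (inside ∷_) (allSubsets k) ++ map (outside ∷_) (allSubsets k)

length-allSubsets : ∀ k → length (allSubsets k) ≡ 2 ^ k
length-allSubsets zero = refl
length-allSubsets (suc k) = begin
  length (map (inside ∷_) ps ++ map (outside ∷_) ps)
    ≡⟨ length-++ (map (inside ∷_) ps) ⟩
  length (map (inside ∷_) ps) + length (map (outside ∷_) ps)
    ≡⟨ cong₂ _+_ (length-map _ ps) (length-map _ ps) ⟩
  length ps + length ps
    ≡⟨ cong₂ _+_ (length-allSubsets k) (trans (length-allSubsets k) (sym (+-identityʳ (2 ^ k)))) ⟩
  2 ^ suc k ∎
  where
  open ≡-Reasoning
  ps = allSubsets k

allSubsets-unique : ∀ k → Unique (allSubsets k)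
allSubsets-unique zero = All.[] AllPairs.∷ AllPairs.[]
allSubsets-unique (suc k) =
  Unique.++⁺ (Unique.map⁺ ∷-injectiveʳ (allSubsets-unique k))
             (Unique.map⁺ ∷-injectiveʳ (allSubsets-unique k))
             disjoint
  where
  disjoint : ∀ {p} → ¬ (p List.∈ map (inside ∷_) (allSubsets k) ×
                        p List.∈ map (outside ∷_) (allSubsets k))
  disjoint (p∈ , p∈′) with ∈-map⁻ (inside ∷_) p∈ | ∈-map⁻ (outside ∷_) p∈′
  ... | _ , _ , refl | _ , _ , ()

module _ {n : ℕ} (G : Graph n) where

  open Graph G using (adj; irrefl)

  adj? : ∀ u v → Dec (Adj G u v)
  adj? u v = adj u v Bool.≟ true

  adj-sym : ∀ {u v} → Adj G u v → Adj G v u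
  adj-sym {u} {v} uv = trans (Graph.sym G v u) uv

  adj⇒≢ : ∀ {u v} → Adj G u v → u ≢ v
  adj⇒≢ {u} uv refl with trans (sym (irrefl u)) uv
  ... | ()

  CanForce : Subset n → Fin n → Fin n → Set
  CanForce B v w = v ∈ B × w ∉ B × Adj G v w × (∀ u → Adj G v u → u ≢ w → u ∈ B)

  canForce? : ∀ B v w → Dec (CanForce B v w)
  canForce? B v w = v ∈? B ×-dec ¬? (w ∈? B) ×-dec adj? v w ×-dec
    all? λ u → adj? v u →-dec (¬? (u ≟ w) →-dec (u ∈? B))

  force : ∀ {B v w} → CanForce B v w → Force G B (B ∪ ⁅ w ⁆)
  force {v = v} {w} (v∈ , w∉ , vw , others) = v , w , v∈ , w∉ , vw , others , refl

  Stalled : Subset n → Set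
  Stalled B = ∀ {v w} → ¬ CanForce B v w

  forcing⇒⊆ : ∀ {B B′} → Star (Force G) B B′ → B ⊆ B′
  forcing⇒⊆ ε = id
  forcing⇒⊆ ((_ , w , _ , _ , _ , _ , refl) ◅ rest) = forcing⇒⊆ rest ∘ p⊆p∪q ⁅ w ⁆

  forcingClosure : ∀ B → ∃ λ B′ → Star (Force G) B B′ × Stalled B′
  forcingClosure B = go B (⊃-wellFounded B)
    where
    go : ∀ B → Acc _⊃_ B → ∃ λ B′ → Star (Force G) B B′ × Stalled B′
    go B (acc rs) with any? (λ v → any? (λ w → canForce? B v w))
    ... | no stuck = B , ε , λ {v} {w} vw → stuck (v , w , vw)
    ... | yes (v , w , vw@(_ , w∉ , _)) with go (B ∪ ⁅ w ⁆) (rs (p⊂p∪⁅x⁆ w∉))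
    ...   | B′ , B→B′ , stalled = B′ , force vw ◅ B→B′ , stalled

  zeroForcing-mono : ∀ {B B′} → B ⊆ B′ → ZeroForcing G B → ZeroForcing G B′
  zeroForcing-mono B⊆B′ ε = subst (ZeroForcing G) (⊆-antisym B⊆B′ ⊆⊤) ε
  zeroForcing-mono {B} {B′} B⊆B′ ((v , w , v∈ , w∉ , vw , others , refl) ◅ rest) with w ∈? B′
  ... | yes w∈ = zeroForcing-mono (p∪⁅x⁆⊆q B⊆B′ w∈) rest
  ... | no w∉′ =
    force (B⊆B′ v∈ , w∉′ , vw , λ u vu u≢w → B⊆B′ (others u vu u≢w)) ◅
    zeroForcing-mono (p∪⁅x⁆⊆q (p⊆p∪q ⁅ w ⁆ ∘ B⊆B′) (x∈p∪⁅x⁆ B′ w)) rest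

  stalled∧zeroForcing⇒⊤ : ∀ {B} → Stalled B → ZeroForcing G B → B ≡ ⊤
  stalled∧zeroForcing⇒⊤ stalled ε = refl
  stalled∧zeroForcing⇒⊤ stalled ((_ , _ , v∈ , w∉ , vw , others , _) ◅ _) =
    ⊥-elim (stalled (v∈ , w∉ , vw , others))

  zeroForcing? : Decidable (ZeroForcing G)
  zeroForcing? B with forcingClosure B
  ... | B′ , B→B′ , stalled with ≡-dec Bool._≟_ B′ ⊤
  ...   | yes refl = yes B→B′
  ...   | no B′≢⊤ =
    no λ zf → B′≢⊤ (stalled∧zeroForcing⇒⊤ stalled (zeroForcing-mono (forcing⇒⊆ B→B′) zf))

  minimumZF : ∃ (MinimumZF G)
  minimumZF = argmin anySubset? ∣_∣ zeroForcing? (⊤ , ε)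

  minimum⇒minimal : ∀ {S} → MinimumZF G S → MinimalZF G S
  minimum⇒minimal (zf , min) = zf , λ T T⊂S zfT → <⇒≱ (p⊂q⇒∣p∣<∣q∣ T⊂S) (min T zfT)

  Forces : (Fin n → ℕ) → Fin n → Fin n → Set
  Forces time v w = Adj G v w × time v < time w × (∀ {x} → Adj G v x → x ≢ w → time x < time w)

  record Chronology (S : Subset n) : Set where
    field
      time      : Fin n → ℕ
      forcer    : Fin n → Fin n
      justified : ∀ {w} → w ∉ S → Forces time (forcer w) w

    forcer-adj : ∀ {w} → w ∉ S → Adj G (forcer w) w
    forcer-adj = proj₁ ∘ justified

    forcer-before : ∀ {w} → w ∉ S → time (forcer w) < time w
    forcer-before = proj₁ ∘ proj₂ ∘ justified

    others-before : ∀ {w x} → w ∉ S → Adj G (forcer w) x → x ≢ w → time x < time w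
    others-before w∉ = proj₂ (proj₂ (justified w∉))

    Forcing : Fin n → Set
    Forcing u = ∃ λ w → w ∉ S × forcer w ≡ u

    forcing? : Decidable Forcing
    forcing? u = any? λ w → ¬? (w ∈? S) ×-dec forcer w ≟ u

    forcer-injective : ∀ {w w′} → w ∉ S → w′ ∉ S → forcer w ≡ forcer w′ → w ≡ w′
    forcer-injective {w} {w′} w∉ w′∉ same with w ≟ w′
    ... | yes w≡w′ = w≡w′
    ... | no w≢w′ = ⊥-elim (<-asym (before w∉ w′∉ same w≢w′) (before w′∉ w∉ (sym same) (w≢w′ ∘ sym)))
      where
      before : ∀ {w w′} → w ∉ S → w′ ∉ S → forcer w ≡ forcer w′ → w ≢ w′ → time w′ < time w
      before w∉ w′∉ same w≢w′ =
        others-before w∉ (subst (λ u → Adj G u _) (sym same) (forcer-adj w′∉)) (w≢w′ ∘ sym)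

  chronology-⊤ : Chronology ⊤
  chronology-⊤ = record { time = λ _ → 0 ; forcer = id ; justified = λ w∉ → ⊥-elim (w∉ ∈⊤) }

  chronology-cons : ∀ {S v w} → CanForce S v w → Chronology (S ∪ ⁅ w ⁆) → Chronology S
  chronology-cons {S} {v} {w} (v∈ , w∉ , vw , others) χ = record
    { time = time ; forcer = forcer ; justified = justified }
    where
    module χ = Chronology χ
    time : Fin n → ℕ
    time x = if does (x ∈? S) then 0 else suc (χ.time x)
    forcer : Fin n → Fin n
    forcer x = if does (x ≟ w) then v else χ.forcer x

    time-∈ : ∀ {x} → x ∈ S → time x ≡ 0
    time-∈ {x} x∈ rewrite dec-true (x ∈? S) x∈ = refl
    time-∉ : ∀ {x} → x ∉ S → time x ≡ suc (χ.time x)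
    time-∉ {x} x∉ rewrite dec-false (x ∈? S) x∉ = refl
    time-≤ : ∀ x → time x ≤ suc (χ.time x)
    time-≤ x with x ∈? S
    ... | yes _ = z≤n
    ... | no _  = ≤-refl

    blue-before : ∀ {x y} → x ∈ S → y ∉ S → time x < time y
    blue-before x∈ y∉ rewrite time-∈ x∈ | time-∉ y∉ = s≤s z≤n
    later : ∀ {x y} → y ∉ S → χ.time x < χ.time y → time x < time y
    later {x} y∉ lt rewrite time-∉ y∉ = ≤-<-trans (time-≤ x) (s≤s lt)

    justified : ∀ {x} → x ∉ S → Forces time (forcer x) x
    justified {x} x∉ with x ≟ w
    ... | yes refl = vw , blue-before v∈ w∉ , λ vu u≢w → blue-before (others _ vu u≢w) w∉
    ... | no x≢w with χ.justified (x∉p∪⁅y⁆ x∉ x≢w)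
    ...   | ux , u<x , others′ = ux , later x∉ u<x , λ uy y≢x → later x∉ (others′ uy y≢x)

  zeroForcing⇒chronology : ∀ {S} → ZeroForcing G S → Chronology S
  zeroForcing⇒chronology ε = chronology-⊤
  zeroForcing⇒chronology ((v , w , v∈ , w∉ , vw , others , refl) ◅ rest) =
    chronology-cons (v∈ , w∉ , vw , others) (zeroForcing⇒chronology rest)

  chronology⇒zeroForcing : ∀ {S} → Chronology S → ZeroForcing G S
  chronology⇒zeroForcing {S} χ with forcingClosure S
  ... | B , S→B , stalled = S→B ◅◅ subst (Star (Force G) B) B≡⊤ ε
    where
    open Chronology χ
    S⊆B = forcing⇒⊆ S→B
    -- The earliest vertex still white in B could be forced, but B is stalled.
    blue : ∀ x → x ∈ B
    blue x with x ∈? B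
    ... | yes x∈ = x∈
    ... | no x∉ with argmin any? time (λ y → ¬? (y ∈? B)) (x , x∉)
    ...   | w , w∉B , earliest = ⊥-elim (stalled (blue-before (forcer-before w∉S) , w∉B , forcer-adj w∉S ,
                                                λ u vu u≢w → blue-before (others-before w∉S vu u≢w)))
      where
      w∉S : w ∉ S
      w∉S = w∉B ∘ S⊆B
      blue-before : ∀ {y} → time y < time w → y ∈ B
      blue-before {y} y<w with y ∈? B
      ... | yes y∈ = y∈
      ... | no y∉ = ⊥-elim (<⇒≱ y<w (earliest y y∉))
    B≡⊤ : B ≡ ⊤
    B≡⊤ = ⊆-antisym ⊆⊤ (λ {x} _ → blue x)

  Closed : (Fin n → Bool) → Set
  Closed Q = ∀ {x y} → Adj G x y → Q x ≡ Q y

  module Reversal {S : Subset n} (χ : Chronology S) (Q : Fin n → Bool) (Q-closed : Closed Q) where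

    open Chronology χ

    InReversed : Fin n → Set
    InReversed x = (Q x ≡ true × ¬ Forcing x) ⊎ (Q x ≡ false × x ∈ S)

    inReversed? : Decidable InReversed
    inReversed? x = (Q x Bool.≟ true ×-dec ¬? (forcing? x)) ⊎-dec (Q x Bool.≟ false ×-dec x ∈? S)

    reversed : Subset n
    reversed = fromDec inReversed?

    ∈reversed-outside : ∀ {x} → Q x ≡ false → x ∈ S → x ∈ reversed
    ∈reversed-outside q x∈ = ∈-fromDec⁺ inReversed? (inj₂ (q , x∈))

    ∈reversed-inside : ∀ {x} → Q x ≡ true → ¬ Forcing x → x ∈ reversed
    ∈reversed-inside q idle = ∈-fromDec⁺ inReversed? (inj₁ (q , idle))

    reversed-outside : ∀ {x} → Q x ≡ false → x ∈ reversed → x ∈ S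
    reversed-outside q x∈ with ∈-fromDec⁻ inReversed? x∈
    ... | inj₁ (q′ , _)  = contradiction (trans (sym q′) q) λ ()
    ... | inj₂ (_ , x∈S) = x∈S

    reversed-inside : ∀ {x} → Q x ≡ true → x ∈ reversed → ¬ Forcing x
    reversed-inside q x∈ with ∈-fromDec⁻ inReversed? x∈
    ... | inj₁ (_ , idle) = idle
    ... | inj₂ (q′ , _)   = contradiction (trans (sym q) q′) λ ()

    M : ℕ
    M = proj₁ (strictUpperBound time)

    time<M : ∀ x → time x < M
    time<M = proj₂ (strictUpperBound time)

    -- If u in Q forced w at time t, then in the reversed process w forces u at time M ∸ t.
    time′ : Fin n → ℕ
    time′ x with Q x | forcing? x
    ... | true  | yes (w , _) = M ∸ time w
    ... | true  | no _        = 0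
    ... | false | _           = time x

    forcer′ : Fin n → Fin n
    forcer′ x with Q x | forcing? x
    ... | true  | yes (w , _) = w
    ... | true  | no _        = x
    ... | false | _           = forcer x

    time′-outside : ∀ {x} → Q x ≡ false → time′ x ≡ time x
    time′-outside q rewrite q = refl

    time′-inside : ∀ {x y} → Q x ≡ true → (∀ {w} → w ∉ S → forcer w ≡ x → time y < time w) →
                   time′ x < M ∸ time y
    time′-inside {x} {y} q later rewrite q with forcing? x
    ... | yes (w , w∉ , w-by-x) = ∸-monoʳ-< (later w∉ w-by-x) (<⇒≤ (time<M w))
    ... | no _                  = m<n⇒0<n∸m (time<M y)

    forcer′-outside : ∀ {x} → Q x ≡ false → forcer′ x ≡ forcer x
    forcer′-outside q rewrite q = refl

    reversed-at-forced : ∀ {v w} → Q v ≡ true → w ∉ S → forcer w ≡ v →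
                         forcer′ v ≡ w × time′ v ≡ M ∸ time w
    reversed-at-forced {v} {w} q w∉ w-by-v rewrite q with forcing? v
    ... | no idle = ⊥-elim (idle (w , w∉ , w-by-v))
    ... | yes (w′ , w′∉ , w′-by-v) with forcer-injective w′∉ w∉ (trans w′-by-v (sym w-by-v))
    ...   | refl = refl , refl

    forces-outside : ∀ {v w} → Q w ≡ false → Forces time v w → Forces time′ v w
    forces-outside {v} {w} q (vw , v<w , others) =
        vw
      , subst₂ _<_ (sym (time′-outside (trans (Q-closed vw) q))) (sym (time′-outside q)) v<w
      , λ vx x≢w → subst₂ _<_ (sym (time′-outside (trans (sym (Q-closed vx)) (trans (Q-closed vw) q))))
                              (sym (time′-outside q)) (others vx x≢w)

    forces-inside : ∀ {v w} → Q v ≡ true → w ∉ S → forcer w ≡ v → Forces time′ w v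
    forces-inside {v} {w} q w∉ w-by-v rewrite proj₂ (reversed-at-forced q w∉ w-by-v) =
      adj-sym wv , time′-inside (trans (Q-closed (adj-sym wv)) q) forced-before ,
      λ {x} wx x≢v → time′-inside (trans (sym (Q-closed wx)) (trans (Q-closed (adj-sym wv)) q))
                                  λ {z} z∉ z-by-x →
                                    others-before z∉ (x-neighbour wx z-by-x) (w≢z x≢v z-by-x)
      where
      wv : Adj G v w
      wv = subst (λ u → Adj G u w) w-by-v (forcer-adj w∉)
      forced-before : ∀ {z} → z ∉ S → forcer z ≡ w → time w < time z
      forced-before z∉ z-by-w = subst (λ u → time u < time _) z-by-w (forcer-before z∉)
      x-neighbour : ∀ {x z} → Adj G w x → forcer z ≡ x → Adj G (forcer z) w
      x-neighbour wx z-by-x = subst (λ u → Adj G u w) (sym z-by-x) (adj-sym wx)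
      w≢z : ∀ {x z} → x ≢ v → forcer z ≡ x → w ≢ z
      w≢z x≢v z-by-x refl = x≢v (trans (sym z-by-x) w-by-v)

    reversed-chronology : Chronology reversed
    reversed-chronology = record { time = time′ ; forcer = forcer′ ; justified = justified′ }
      where
      justified′ : ∀ {v} → v ∉ reversed → Forces time′ (forcer′ v) v
      justified′ {v} v∉ = by-side (Q v) refl
        where
        inQ : Q v ≡ true → Dec (Forcing v) → Forces time′ (forcer′ v) v
        inQ q (yes (w , w∉ , w-by-v)) =
          subst (λ u → Forces time′ u v) (sym (proj₁ (reversed-at-forced q w∉ w-by-v))) (forces-inside q w∉ w-by-v)
        inQ q (no idle) = ⊥-elim (v∉ (∈reversed-inside q idle))
        by-side : ∀ b → Q v ≡ b → Forces time′ (forcer′ v) v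
        by-side true  q = inQ q (forcing? v)
        by-side false q = subst (λ u → Forces time′ u v) (sym (forcer′-outside q))
                                (forces-outside q (justified (v∉ ∘ ∈reversed-outside q)))

    twist : Fin n → Fin n
    twist x = if Q x then forcer x else x

    twist-inside : ∀ {x} → Q x ≡ true → twist x ≡ forcer x
    twist-inside q rewrite q = refl

    twist-outside : ∀ {x} → Q x ≡ false → twist x ≡ x
    twist-outside q rewrite q = refl

    Q-twist : ∀ {x} → x ∉ S → Q (twist x) ≡ Q x
    Q-twist {x} x∉ with Q x in q
    ... | true  = trans (Q-closed (forcer-adj x∉)) q
    ... | false = q

    twist-∉ : ∀ {x} → x ∉ S → twist x ∉ reversed
    twist-∉ {x} x∉ with Q x in q
    ... | true  = λ fx∈ → reversed-inside (trans (Q-closed (forcer-adj x∉)) q) fx∈ (x , x∉ , refl)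
    ... | false = x∉ ∘ reversed-outside q

    twist-injective : ∀ {x y} → x ∉ S → y ∉ S → twist x ≡ twist y → x ≡ y
    twist-injective {x} {y} x∉ y∉ e
      with Q x in qx | Q y in qy | trans (sym (Q-twist x∉)) (trans (cong Q e) (Q-twist y∉))
    ... | true  | true  | _ =
      forcer-injective x∉ y∉ (trans (sym (twist-inside qx)) (trans e (twist-inside qy)))
    ... | false | false | _ = trans (sym (twist-outside qx)) (trans e (twist-outside qy))
    ... | true  | false | ()
    ... | false | true  | ()

    ∣reversed∣≤∣S∣ : ∣ reversed ∣ ≤ ∣ S ∣
    ∣reversed∣≤∣S∣ = ∣∁p∣≤∣∁q∣⇒∣q∣≤∣p∣ S reversed
      (injection⇒∣p∣≤∣q∣ twist (x∉p⇒x∈∁p ∘ twist-∉ ∘ x∈∁p⇒x∉p)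
                                (λ x∈ y∈ → twist-injective (x∈∁p⇒x∉p x∈) (x∈∁p⇒x∉p y∈)))

    reversed-minimum : MinimumZF G S → MinimumZF G reversed
    reversed-minimum (_ , minimum) =
      chronology⇒zeroForcing reversed-chronology , λ T zf → ≤-trans ∣reversed∣≤∣S∣ (minimum T zf)

    lookup-reversed-forcing : ∀ {u} → u ∈ S → Forcing u → lookup reversed u ≡ not (Q u)
    lookup-reversed-forcing {u} u∈ u-forces = trans (lookup-fromDec inReversed?) (by-side (Q u) refl)
      where
      by-side : ∀ b → Q u ≡ b → does (inReversed? u) ≡ not b
      by-side true  q = dec-false (inReversed? u) λ where
        (inj₁ (_ , idle)) → idle u-forces
        (inj₂ (q′ , _))   → contradiction (trans (sym q) q′) λ ()
      by-side false q = dec-true (inReversed? u) (inj₂ (q , u∈))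

  zeroForcing-drop : ∀ {S v w} → ZeroForcing G S → v ∈ S → Adj G v w → (∀ {u} → Adj G v u → u ∈ S) →
                     ZeroForcing G (S - w)
  zeroForcing-drop {S} {v} {w} zf v∈ vw nbrs =
    force (x∈p∧x≢y⇒x∈p-y v∈ (adj⇒≢ vw) , x∉p-x S w , vw , λ u vu u≢w → x∈p∧x≢y⇒x∈p-y (nbrs vu) u≢w)
      ◅ zeroForcing-mono (p⊆p-x∪⁅x⁆ S w) zf

  -- If C ⊆ S, then r could be dropped from S, since w forces it back.
  minimum-white-in-class : ∀ {S C r w} → MinimumZF G S → Closed C → C r ≡ true → Adj G r w →
                           ∃ λ y → C y ≡ true × y ∉ S
  minimum-white-in-class {S} {C} {r} {w} (zf , minimum) C-closed Cr rw
    with any? (λ y → C y Bool.≟ true ×-dec ¬? (y ∈? S))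
  ... | yes white = white
  ... | no none = ⊥-elim (<⇒≱ (x∈p⇒∣p-x∣<∣p∣ (blue Cr)) (minimum (S - r) zf′))
    where
    blue : ∀ {y} → C y ≡ true → y ∈ S
    blue {y} Cy with y ∈? S
    ... | yes y∈ = y∈
    ... | no y∉  = ⊥-elim (none (y , Cy , y∉))
    Cw : C w ≡ true
    Cw = trans (sym (C-closed rw)) Cr
    zf′ : ZeroForcing G (S - r)
    zf′ = zeroForcing-drop zf (blue Cw) (adj-sym rw) (λ wu → blue (trans (sym (C-closed wu)) Cw))

  forcer-in-class : ∀ {S C y} (χ : Chronology S) → Closed C → C y ≡ true → y ∉ S →
                    ∃ λ u → C u ≡ true × u ∈ S × Chronology.Forcing χ u
  forcer-in-class {S} {C} {y} χ C-closed Cy y∉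
    with argmin any? (Chronology.time χ) (λ x → C x Bool.≟ true ×-dec ¬? (x ∈? S)) (y , Cy , y∉)
  ... | w , (Cw , w∉) , earliest = forcer w , Cu , blue , w , w∉ , refl
    where
    open Chronology χ
    Cu : C (forcer w) ≡ true
    Cu = trans (C-closed (forcer-adj w∉)) Cw
    blue : forcer w ∈ S
    blue with forcer w ∈? S
    ... | yes u∈ = u∈
    ... | no u∉  = ⊥-elim (<⇒≱ (forcer-before w∉) (earliest _ (Cu , u∉)))

  module Components {k} (H : HasNontrivialComponents G k) where

    root : Fin k → Fin n
    root = proj₁ H

    distinct : ∀ i j → Connected G (root i) (root j) → i ≡ j
    distinct = proj₁ (proj₂ H)

    nontrivial : ∀ i → ∃ λ w → Adj G (root i) w
    nontrivial = proj₁ (proj₂ (proj₂ H))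

    covered : ∀ v → (∃ λ w → Adj G v w) → ∃ λ i → Connected G v (root i)
    covered = proj₂ (proj₂ (proj₂ H))

    label : Fin n → Maybe (Fin k)
    label x with any? (adj? x)
    ... | yes x-nontrivial = just (proj₁ (covered x x-nontrivial))
    ... | no _             = nothing

    label-connected : ∀ {x i} → (∃ λ w → Adj G x w) → Connected G x (root i) → label x ≡ just i
    label-connected {x} {i} x-nontrivial x~i with any? (adj? x)
    ... | yes x-nt     = cong just (distinct _ i (reverse adj-sym (proj₂ (covered x x-nt)) ◅◅ x~i))
    ... | no isolated = contradiction x-nontrivial isolated

    label-adj : ∀ {x y} → Adj G x y → label x ≡ label y
    label-adj {x} {y} xy with covered x (y , xy)
    ... | i , x~i = trans (label-connected (y , xy) x~i)
                          (sym (label-connected (x , adj-sym xy) (adj-sym xy ◅ x~i)))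

    inComponents : Subset k → Fin n → Bool
    inComponents b x = maybe′ (lookup b) false (label x)

    inComponents-closed : ∀ b → Closed (inComponents b)
    inComponents-closed b = cong (maybe′ (lookup b) false) ∘ label-adj

    inComponents-root : ∀ i → inComponents ⁅ i ⁆ (root i) ≡ true
    inComponents-root i rewrite label-connected {i = i} (nontrivial i) ε = []=⇒lookup (x∈⁅x⁆ i)

    inComponents-⁅⁆ : ∀ {i x} b → inComponents ⁅ i ⁆ x ≡ true → inComponents b x ≡ lookup b i
    inComponents-⁅⁆ {i} {x} b = go (label x)
      where
      go : ∀ m → maybe′ (lookup ⁅ i ⁆) false m ≡ true → maybe′ (lookup b) false m ≡ lookup b i
      go (just j) j∈ = cong (lookup b) (x∈⁅y⁆⇒x≡y i (lookup⇒[]= j ⁅ i ⁆ j∈))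
      go nothing ()

  module _ {k} (H : HasNontrivialComponents G k) {S} (S-minimum : MinimumZF G S) where

    open Components H

    χ : Chronology S
    χ = zeroForcing⇒chronology (proj₁ S-minimum)

    module Flip b = Reversal χ (inComponents b) (inComponents-closed b)

    flipped : Subset k → Subset n
    flipped b = Flip.reversed b

    flipped-minimum : ∀ b → MinimumZF G (flipped b)
    flipped-minimum b = Flip.reversed-minimum b S-minimum

    flipped-injective : ∀ {b b′} → flipped b ≡ flipped b′ → b ≡ b′
    flipped-injective {b} {b′} same =
      trans (sym (tabulate∘lookup b)) (trans (tabulate-cong agree) (tabulate∘lookup b′))
      where
      agree : ∀ i → lookup b i ≡ lookup b′ i
      agree i with minimum-white-in-class S-minimum (inComponents-closed ⁅ i ⁆) (inComponents-root i)
                                          (proj₂ (nontrivial i))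
      ... | y , Cy , y∉ with forcer-in-class χ (inComponents-closed ⁅ i ⁆) Cy y∉
      ... | u , Cu , u∈ , u-forces = Bool.not-injective (begin
        not (lookup b i)          ≡⟨ cong not (sym (inComponents-⁅⁆ b Cu)) ⟩
        not (inComponents b u)    ≡⟨ sym (Flip.lookup-reversed-forcing b u∈ u-forces) ⟩
        lookup (flipped b) u      ≡⟨ cong (λ R → lookup R u) same ⟩
        lookup (flipped b′) u     ≡⟨ Flip.lookup-reversed-forcing b′ u∈ u-forces ⟩
        not (inComponents b′ u)   ≡⟨ cong not (inComponents-⁅⁆ b′ Cu) ⟩
        not (lookup b′ i)         ∎)
        where open ≡-Reasoning

    flipped-family : Σ (List (Subset n)) λ L → Unique L × All (MinimumZF G) L × length L ≡ 2 ^ k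
    flipped-family =
        map flipped (allSubsets k)
      , Unique.map⁺ flipped-injective (allSubsets-unique k)
      , All.map⁺ (All.tabulate λ {b} _ → flipped-minimum b)
      , trans (length-map flipped (allSubsets k)) (length-allSubsets k)

  minimumZF-family : ∀ {k} → HasNontrivialComponents G k →
    Σ (List (Subset n)) λ L → Unique L × All (MinimumZF G) L × length L ≡ 2 ^ k
  minimumZF-family H with minimumZF
  ... | _ , S-minimum = flipped-family H S-minimum

Ω-fromMinimum : (P : {n : ℕ} → Graph n → Subset n → Set) →
                (∀ {n} (G : Graph n) {S} → MinimumZF G S → P G S) → OmegaTwoPow P
Ω-fromMinimum P weaken = 1 , 0 , λ n G k H _ → family G H
  where
  family : ∀ {n} (G : Graph n) {k} → HasNontrivialComponents G k →
           Σ (List (Subset n)) λ L → Unique L × All (P G) L × 2 ^ k ≤ 1 * length L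
  family G H =
    let L , unique , minimum , length≡2^k = minimumZF-family G H in
    L , unique , All.map (weaken G) minimum , ≤-reflexive (sym (trans (*-identityˡ _) length≡2^k))

corollary2p5 : OmegaTwoPow MinimalZF × OmegaTwoPow MinimumZF
corollary2p5 = Ω-fromMinimum MinimalZF minimum⇒minimal , Ω-fromMinimum MinimumZF (λ _ → id)
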